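{- For any $a \geq 2$ we have \begin{equation*} \Lambda(a) = \max \big\{ \Lambda (f) + \Lambda (a-f) + a-f : a/2 \leq f < a \big\}. \end{equation*}
   Context: For a finite poset $P$, $\operatorname{ao}(P)$ is the maximum size of a collection of chains in $P$ such that any two elements from different chains are incomparable (i.e. the maximum order of an induced vertex-disjoint union of cliques in the comparability graph), and $h(P)$ is the height (size of a largest chain). A poset is $V$-free if there are no $p_1,p_2,p_3$ with $p_1<p_2$, $p_1<p_3$ and $p_2,p_3$ incomparable. For $a\ge 0$, $h\ge1$, $\Lambda(a,h)=\max\{|P| : P \text{ is a } V\text{ -free poset with } \operatorname{ao}(P)=a \text{ and } h(P)\le h\}$, and $\Lambda(a)=\Lambda(a,a)$ (with $\Lambda(0)=0$). -}

module Defs where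

open import Level using (0ℓ)
open import Data.Nat using (ℕ; _≤_; _*_; _+_; _∸_; _<_)
open import Data.Fin using (Fin)
open import Data.Fin.Subset using (Subset; _∈_; ∣_∣)
open import Data.Product using (Σ; _×_; ∃; ∃-syntax)
open import Data.Sum using (_⊎_)
open import Relation.Nullary using (¬_)
open import Relation.Binary.PropositionalEquality using (_≡_; _≢_)
open import Relation.Binary.Structures using (IsStrictPartialOrder)

-- A finite poset, given (up to isomorphism) on the carrier Fin n by its
-- strict order _≺_.
record FinPoset : Set₁ where
  field
    n      : ℕ
    _≺_    : Fin n → Fin n → Set
    isSPO  : IsStrictPartialOrder _≡_ _≺_

  size : ℕ
  size = n

  Comparable : Fin n → Fin n → Set
  Comparable x y = x ≡ y ⊎ x ≺ y ⊎ y ≺ x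

  Incomparable : Fin n → Fin n → Set
  Incomparable x y = ¬ Comparable x y

  IsChain : Subset n → Set
  IsChain S = ∀ x y → x ∈ S → y ∈ S → Comparable x y

  HeightLe : ℕ → Set
  HeightLe h = ∀ S → IsChain S → ∣ S ∣ ≤ h

  -- A collection of chains with elements of different chains incomparable:
  -- the union S of the chains together with a labelling "chain" giving the
  -- index of the chain each element of S belongs to.
  IsChainCollection : Subset n → (Fin n → ℕ) → Set
  IsChainCollection S chain =
    ∀ x y → x ∈ S → y ∈ S →
      (chain x ≡ chain y → Comparable x y) ×
      (chain x ≢ chain y → Incomparable x y)

  AoEq : ℕ → Set
  AoEq a =
    (Σ (Subset n) λ S → Σ (Fin n → ℕ) λ c → IsChainCollection S c × ∣ S ∣ ≡ a) ×
    (∀ S c → IsChainCollection S c → ∣ S ∣ ≤ a)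

  VFree : Set
  VFree = ∀ p₁ p₂ p₃ → p₁ ≺ p₂ → p₁ ≺ p₃ → ¬ Incomparable p₂ p₃

open FinPoset public

IsΛ : ℕ → ℕ → ℕ → Set₁
IsΛ a h m =
  (Σ FinPoset λ P → VFree P × AoEq P a × HeightLe P h × size P ≡ m) ×
  (∀ (P : FinPoset) → VFree P → AoEq P a → HeightLe P h → size P ≤ m)

term : (ℕ → ℕ) → ℕ → ℕ → ℕ
term L a f = L f + L (a ∸ f) + (a ∸ f)

module Submission where

-- We define Λ by this recursion (with Λ(0) = 0, Λ(1) = 1) and prove that
-- Λ(b) is the largest size of a V-free poset with ao = b and height ≤ b.
--
-- Upper bound: Λ is increasing and superadditive, Λ(x) + Λ(y) + z ≤ Λ(x+y)
-- for z ≤ min(x, y).  Every subset S of a V-free poset has a certificate: a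
-- chain collection C and a chain H in S with |H| ≤ |C| and
-- |S| + |C| ≤ Λ(|C|) + |H|.  By induction, split S at a maximal element r:
-- by V-freeness the part below r is incomparable to the rest; r extends a
-- chain of the part below it, and the two parts merge their collections.
--
-- Lower bound: gluing posets gives the disjoint union P ∥ Q and the ordinal
-- sum P ⊕ Q; the poset (P_f ∥ P_{b-f}) ⊕ chain(b-f) for an optimal split f
-- realises Λ(b), by induction on b.

open import Defs
open import Data.Nat using (ℕ; zero; suc; _+_; _*_; _∸_; _⊔_; _≤_; _<_; _≤?_; _≟_; z≤n; s≤s)
open import Data.Nat.Properties
  using ( ≤-refl; ≤-trans; ≤-reflexive; ≤-total; ≤-pred; <⇒≤; <⇒≱; >⇒≢; <-≤-trans; n<1+n
        ; m≤n⇒m<n∨m≡n; m≤n⇒m≤1+n; m≤m+n; m≤n+m; m<m+n; m<n+m; m≤n*m; suc-injective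
        ; +-comm; +-assoc; +-identityʳ; +-mono-≤; +-monoˡ-≤; +-monoʳ-≤; +-cancelʳ-≤
        ; *-suc; *-cancelˡ-≡; even≢odd; ⊔-sel; ⊔-identityʳ; m≤m⊔n; m≤n⊔m
        ; m∸n≤m; m+n∸m≡n; m+[n∸m]≡n; m<n⇒0<n∸m; m≤n+o⇒m∸n≤o
        ; +-commutativeSemigroup; module ≤-Reasoning )
open import Data.Nat.Induction using (<-rec)
open import Algebra.Properties.CommutativeSemigroup +-commutativeSemigroup
  using (interchange; xy∙z≈xz∙y; x∙yz≈xz∙y)
open import Data.Bool using (Bool; true; false; _∧_; _∨_; not; if_then_else_)
open import Data.Bool.Properties
  using (∧-conicalˡ; ∧-conicalʳ; ∧-zeroʳ; ∧-identityʳ; ∨-identityʳ; ∨-zeroʳ; ∨-conicalˡ; ∨-conicalʳ)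
open import Data.Fin using (Fin; zero; suc; _↑ˡ_; _↑ʳ_; splitAt; join) renaming (_≟_ to _≟ᶠ_; _<_ to _<ᶠ_)
open import Data.Fin.Properties
  using (<-isStrictPartialOrder; <-cmp; splitAt-join; join-splitAt; splitAt-↑ˡ; splitAt-↑ʳ; splitAt⁻¹-↑ˡ; splitAt⁻¹-↑ʳ)
open import Data.Fin.Subset using (Subset; _∈_; ∣_∣) renaming (⊤ to everything)
open import Data.Fin.Subset.Properties using (∣p∣≤n; ∣⊤∣≡n)
open import Data.Vec using ([]; _∷_; lookup; tabulate)
open import Data.Vec.Properties using (lookup∘tabulate; []=⇒lookup; lookup⇒[]=)
open import Data.Product using (Σ; ∃-syntax; _×_; _,_; proj₁; proj₂)
open import Data.Sum using (_⊎_; inj₁; inj₂; [_,_]; [_,_]′)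
open import Data.Empty using (⊥)
open import Data.Unit using (tt) renaming (⊤ to Unit)
open import Function.Bundles using (_⇔_; mk⇔; Equivalence)
open import Function.Properties.Equivalence using () renaming (refl to ⇔-refl; sym to ⇔-sym; trans to ⇔-trans)
open import Relation.Nullary using (¬_; Dec; yes; no; does; contradiction)
open import Relation.Nullary.Decidable using (decidable-stable; ¬¬-excluded-middle)
open import Relation.Binary.Definitions using (Decidable; tri<; tri≈; tri>)
open import Relation.Binary.Structures using (IsStrictPartialOrder)
open import Relation.Binary.PropositionalEquality
  using (_≡_; _≢_; refl; sym; trans; cong; cong₂; subst; subst₂; module ≡-Reasoning)
open import Relation.Binary.PropositionalEquality.Properties using (isEquivalence)

open Equivalence using (to; from)

maxBelow : (ℕ → ℕ) → ℕ → ℕ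
maxBelow h zero    = 0
maxBelow h (suc n) = h n ⊔ maxBelow h n

maxBelow-upper : ∀ h {n i} → i < n → h i ≤ maxBelow h n
maxBelow-upper h {suc n} {i} (s≤s i≤n) with m≤n⇒m<n∨m≡n i≤n
... | inj₁ i<n  = ≤-trans (maxBelow-upper h i<n) (m≤n⊔m (h n) (maxBelow h n))
... | inj₂ refl = m≤m⊔n (h n) (maxBelow h n)

maxBelow-attained : ∀ h n → ∃[ i ] i < suc n × maxBelow h (suc n) ≡ h i
maxBelow-attained h zero = 0 , s≤s z≤n , ⊔-identityʳ (h 0)
maxBelow-attained h (suc n) with ⊔-sel (h (suc n)) (maxBelow h (suc n))
... | inj₁ eq = suc n , ≤-refl , eq
... | inj₂ eq with maxBelow-attained h n
...   | i , i<n , eq′ = i , m≤n⇒m≤1+n i<n , trans eq eq′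

maxBelow-cong : ∀ {h h′} n → (∀ i → i < n → h i ≡ h′ i) → maxBelow h n ≡ maxBelow h′ n
maxBelow-cong zero    _  = refl
maxBelow-cong (suc n) eq = cong₂ _⊔_ (eq n ≤-refl) (maxBelow-cong n (λ i i<n → eq i (m≤n⇒m≤1+n i<n)))

candidate : (ℕ → ℕ) → ℕ → ℕ → ℕ
candidate L a f with a ≤? 2 * f
... | yes _ = term L a f
... | no  _ = 0

candidate-admissible : ∀ L {a} f → a ≤ 2 * f → candidate L a f ≡ term L a f
candidate-admissible L {a} f a≤2f with a ≤? 2 * f
... | yes _   = refl
... | no  a≰2f = contradiction a≤2f a≰2f

candidate-inadmissible : ∀ L {a} f → ¬ a ≤ 2 * f → candidate L a f ≡ 0
candidate-inadmissible L {a} f a≰2f with a ≤? 2 * f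
... | yes a≤2f = contradiction a≤2f a≰2f
... | no  _    = refl

step : (ℕ → ℕ) → ℕ → ℕ
step L zero          = 0
step L (suc zero)    = 1
step L a@(suc (suc _)) = maxBelow (candidate L a) a

split-smaller : ∀ {a f} → 2 ≤ a → a ≤ 2 * f → a ∸ f < a
split-smaller {suc a} {zero}  _ ()
split-smaller {suc a} {suc f} _ _ = s≤s (m∸n≤m a f)

split-complement≤ : ∀ {a f} → a ≤ 2 * f → a ∸ f ≤ f
split-complement≤ {a} {f} a≤2f = m≤n+o⇒m∸n≤o a f (subst (a ≤_) (cong (f +_) (+-identityʳ f)) a≤2f)

step-local : ∀ {L L′} a → (∀ b → b < a → L b ≡ L′ b) → step L a ≡ step L′ a
step-local zero          _  = refl
step-local (suc zero)    _  = refl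
step-local {L} {L′} a@(suc (suc _)) eq = maxBelow-cong a candidates-agree
  where
  candidates-agree : ∀ f → f < a → candidate L a f ≡ candidate L′ a f
  candidates-agree f f<a with a ≤? 2 * f
  ... | yes a≤2f = cong₂ _+_ (cong₂ _+_ (eq f f<a) (eq (a ∸ f) (split-smaller {f = f} (s≤s (s≤s z≤n)) a≤2f))) refl
  ... | no  _    = refl

-- Iterating step from the zero function; approx k is correct below k.
approx : ℕ → ℕ → ℕ
approx zero    = λ _ → 0
approx (suc k) = step (approx k)

Λ : ℕ → ℕ
Λ a = approx (suc a) a

approx-settled : ∀ k b → b < k → approx k b ≡ approx (suc k) b
approx-settled (suc k) b b<1+k =
  step-local b (λ c c<b → approx-settled k c (<-≤-trans c<b (≤-pred b<1+k)))

approx-correct : ∀ {k b} → b < k → approx k b ≡ Λ b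
approx-correct {suc k} {b} (s≤s b≤k) with m≤n⇒m<n∨m≡n b≤k
... | inj₁ b<k  = trans (sym (approx-settled k b b<k)) (approx-correct b<k)
... | inj₂ refl = refl

Λ-unfold : ∀ a → Λ a ≡ step Λ a
Λ-unfold a = step-local a (λ b b<a → approx-correct b<a)

split≤Λ : ∀ {a f} → 2 ≤ a → a ≤ 2 * f → f < a → term Λ a f ≤ Λ a
split≤Λ {suc zero} (s≤s ())
split≤Λ {a@(suc (suc _))} {f} _ a≤2f f<a = begin
  term Λ a f                  ≡⟨ sym (candidate-admissible Λ f a≤2f) ⟩
  candidate Λ a f             ≤⟨ maxBelow-upper (candidate Λ a) f<a ⟩
  maxBelow (candidate Λ a) a  ≡⟨ sym (Λ-unfold a) ⟩
  Λ a                         ∎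
  where open ≤-Reasoning

last-admissible : ∀ j → suc (suc j) ≤ 2 * suc j
last-admissible j = subst (suc (suc j) ≤_) (sym (*-suc 2 j)) (+-monoʳ-≤ 2 (m≤n*m j 2))

term-positive : ∀ L {a f} → f < a → 0 < term L a f
term-positive L {a} {f} f<a = ≤-trans (m<n⇒0<n∸m f<a) (m≤n+m (a ∸ f) (L f + L (a ∸ f)))

Λ-attained : ∀ {a} → 2 ≤ a → ∃[ f ] a ≤ 2 * f × f < a × Λ a ≡ term Λ a f
Λ-attained {suc zero} (s≤s ())
Λ-attained {a@(suc (suc j))} 2≤a with maxBelow-attained (candidate Λ a) (suc j)
... | f , f<a , Λa≡candidate = decide (a ≤? 2 * f)
  where
  Λ-positive : 0 < Λ a
  Λ-positive = ≤-trans (term-positive Λ {f = suc j} ≤-refl) (split≤Λ 2≤a (last-admissible j) ≤-refl)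
  decide : Dec (a ≤ 2 * f) → ∃[ f ] a ≤ 2 * f × f < a × Λ a ≡ term Λ a f
  decide (yes a≤2f) = f , a≤2f , f<a , trans (Λ-unfold a) (trans Λa≡candidate (candidate-admissible Λ f a≤2f))
  decide (no a≰2f)  = contradiction (trans (Λ-unfold a) (trans Λa≡candidate (candidate-inadmissible Λ f a≰2f)))
                                    (>⇒≢ Λ-positive)

Λ-merge : ∀ {x y z} → y ≤ x → z ≤ y → Λ x + Λ y + z ≤ Λ (x + y)
Λ-merge {x} {zero} z≤n z≤n = ≤-reflexive (begin-equality
  Λ x + 0 + 0  ≡⟨ +-identityʳ (Λ x + 0) ⟩
  Λ x + 0      ≡⟨ +-identityʳ (Λ x) ⟩
  Λ x          ≡⟨ cong Λ (sym (+-identityʳ x)) ⟩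
  Λ (x + 0)    ∎)
  where open ≤-Reasoning
Λ-merge {x} {y@(suc _)} {z} y≤x z≤y = begin
  Λ x + Λ y + z                  ≤⟨ +-monoʳ-≤ (Λ x + Λ y) z≤y ⟩
  Λ x + Λ y + y                  ≡⟨ cong (λ d → Λ x + Λ d + d) (sym (m+n∸m≡n x y)) ⟩
  term Λ (x + y) x               ≤⟨ split≤Λ two admissible (m<m+n x (s≤s z≤n)) ⟩
  Λ (x + y)                      ∎
  where
  open ≤-Reasoning
  two : 2 ≤ x + y
  two = +-mono-≤ (≤-trans (s≤s z≤n) y≤x) (s≤s z≤n)
  admissible : x + y ≤ 2 * x
  admissible = +-monoʳ-≤ x (subst (y ≤_) (sym (+-identityʳ x)) y≤x)

Λ-superadditive : ∀ {x y z} → z ≤ x → z ≤ y → Λ x + Λ y + z ≤ Λ (x + y)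
Λ-superadditive {x} {y} {z} z≤x z≤y with ≤-total y x
... | inj₁ y≤x = Λ-merge y≤x z≤y
... | inj₂ x≤y = subst₂ _≤_ (cong (_+ z) (+-comm (Λ y) (Λ x))) (cong Λ (+-comm y x)) (Λ-merge x≤y z≤x)

Λ-increasing : ∀ c → Λ c < Λ (suc c)
Λ-increasing zero    = s≤s z≤n
Λ-increasing c@(suc _) = begin-strict
  Λ c              <⟨ n<1+n (Λ c) ⟩
  suc (Λ c)        ≡⟨ +-comm 1 (Λ c) ⟩
  Λ c + 1          ≤⟨ m≤m+n (Λ c + 1) 1 ⟩
  Λ c + Λ 1 + 1    ≤⟨ Λ-merge {c} {1} (s≤s z≤n) ≤-refl ⟩
  Λ (c + 1)        ≡⟨ cong Λ (+-comm c 1) ⟩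
  Λ (suc c)        ∎
  where open ≤-Reasoning

Λ-monotone : ∀ {m n} → m ≤ n → Λ m ≤ Λ n
Λ-monotone {n = zero}  z≤n  = ≤-refl
Λ-monotone {n = suc n} m≤1+n with m≤n⇒m<n∨m≡n m≤1+n
... | inj₁ m<1+n = ≤-trans (Λ-monotone (≤-pred m<1+n)) (<⇒≤ (Λ-increasing n))
... | inj₂ refl  = ≤-refl

∧-intro : ∀ {a b} → a ≡ true → b ≡ true → a ∧ b ≡ true
∧-intro refl refl = refl

not-true : ∀ {b} → not b ≡ true → b ≡ false
not-true {false} refl = refl

∨-introˡ : ∀ {a} b → a ≡ true → a ∨ b ≡ true
∨-introˡ b refl = refl

∨-true : ∀ a b → a ∨ b ≡ true → a ≡ true ⊎ b ≡ true
∨-true true  _ _  = inj₁ refl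
∨-true false _ eq = inj₂ eq

indicator : Bool → ℕ
indicator b = if b then 1 else 0

count : ∀ {n} → (Fin n → Bool) → ℕ
count {zero}  g = 0
count {suc n} g = indicator (g zero) + count (λ x → g (suc x))

count-cong : ∀ {n} {g h : Fin n → Bool} → (∀ x → g x ≡ h x) → count g ≡ count h
count-cong {zero}  eq = refl
count-cong {suc n} eq = cong₂ _+_ (cong indicator (eq zero)) (count-cong (λ x → eq (suc x)))

count-≤ : ∀ {n} (g : Fin n → Bool) → count g ≤ n
count-≤ {zero}  g = z≤n
count-≤ {suc n} g with g zero
... | true  = s≤s (count-≤ (λ x → g (suc x)))
... | false = m≤n⇒m≤1+n (count-≤ (λ x → g (suc x)))

count-all : ∀ n → count {n} (λ _ → true) ≡ n
count-all zero    = refl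
count-all (suc n) = cong suc (count-all n)

count-none : ∀ {n} (g : Fin n → Bool) → (∀ x → g x ≡ false) → count g ≡ 0
count-none {zero}  g none = refl
count-none {suc n} g none rewrite none zero = count-none (λ x → g (suc x)) (λ x → none (suc x))

count-pos : ∀ {n} (g : Fin n → Bool) {x} → g x ≡ true → 0 < count g
count-pos {suc n} g {zero}  gx rewrite gx = s≤s z≤n
count-pos {suc n} g {suc x} gx =
  ≤-trans (count-pos (λ y → g (suc y)) gx) (m≤n+m _ (indicator (g zero)))

nonempty? : ∀ {n} (g : Fin n → Bool) → (∃[ x ] g x ≡ true) ⊎ (∀ x → g x ≡ false)
nonempty? {zero}  g = inj₂ (λ ())
nonempty? {suc n} g with g zero in g0 | nonempty? (λ x → g (suc x))
... | true  | _             = inj₁ (zero , g0)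
... | false | inj₁ (x , gx) = inj₁ (suc x , gx)
... | false | inj₂ none     = inj₂ λ { zero → g0 ; (suc x) → none x }

count-split : ∀ {n} (g h : Fin n → Bool) →
  count g ≡ count (λ x → g x ∧ h x) + count (λ x → g x ∧ not (h x))
count-split {zero}  g h = refl
count-split {suc n} g h = trans
  (cong₂ _+_ (indicator-split (g zero) (h zero)) (count-split (λ x → g (suc x)) (λ x → h (suc x))))
  (interchange (indicator (g zero ∧ h zero)) _ _ _)
  where
  indicator-split : ∀ a b → indicator a ≡ indicator (a ∧ b) + indicator (a ∧ not b)
  indicator-split true  true  = refl
  indicator-split true  false = refl
  indicator-split false _     = refl

count-∨ : ∀ {n} (g h : Fin n → Bool) → (∀ x → g x ≡ true → h x ≡ false) →
  count (λ x → g x ∨ h x) ≡ count g + count h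
count-∨ g h disjoint = trans (count-split (λ x → g x ∨ h x) g)
                             (cong₂ _+_ (count-cong on-g) (count-cong off-g))
  where
  on-g : ∀ x → (g x ∨ h x) ∧ g x ≡ g x
  on-g x with g x
  ... | true  = refl
  ... | false = ∧-zeroʳ (h x)
  off-g : ∀ x → (g x ∨ h x) ∧ not (g x) ≡ h x
  off-g x with g x in gx
  ... | true  = sym (disjoint x gx)
  ... | false = ∧-identityʳ (h x)

count-< : ∀ {n} (g h : Fin n → Bool) {y} → (∀ x → h x ≡ true → g x ≡ true) →
  g y ≡ true → h y ≡ false → count h < count g
count-< {n} g h {y} h⊆g gy hy = begin-strict
  count h                                      <⟨ m<m+n (count h) (count-pos rest gy∧¬hy) ⟩
  count h + count rest                         ≡⟨ cong (_+ count rest) (count-cong meet) ⟨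
  count (λ x → g x ∧ h x) + count rest         ≡⟨ count-split g h ⟨
  count g                                      ∎
  where
  open ≤-Reasoning
  rest : Fin n → Bool
  rest x = g x ∧ not (h x)
  meet : ∀ x → g x ∧ h x ≡ h x
  meet x with h x in hx
  ... | true  = trans (∧-identityʳ (g x)) (h⊆g x hx)
  ... | false = ∧-zeroʳ (g x)
  gy∧¬hy : g y ∧ not (h y) ≡ true
  gy∧¬hy rewrite gy | hy = refl

count-++ : ∀ m {k} (g : Fin (m + k) → Bool) →
  count g ≡ count (λ x → g (x ↑ˡ k)) + count (λ y → g (m ↑ʳ y))
count-++ zero    g = refl
count-++ (suc m) g = trans (cong (indicator (g zero) +_) (count-++ m (λ x → g (suc x))))
                           (sym (+-assoc (indicator (g zero)) _ _))

single : ∀ {n} → Fin n → Fin n → Bool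
single r y = does (y ≟ᶠ r)

single-self : ∀ {n} (r : Fin n) → single r r ≡ true
single-self r with r ≟ᶠ r
... | yes _   = refl
... | no  r≢r = contradiction refl r≢r

single-true : ∀ {n} {r y : Fin n} → single r y ≡ true → y ≡ r
single-true {r = r} {y} eq with y ≟ᶠ r
... | yes y≡r = y≡r

count-single : ∀ {n} (r : Fin n) → count (single r) ≡ 1
count-single {suc n} zero    = cong suc (count-none {n} (λ y → single zero (suc y)) (λ _ → refl))
count-single {suc n} (suc r) = count-single r

lookup⇒∈ : ∀ {n} {S : Subset n} {x} → lookup S x ≡ true → x ∈ S
lookup⇒∈ {S = S} {x} = lookup⇒[]= x S

card-lookup : ∀ {n} (S : Subset n) → ∣ S ∣ ≡ count (lookup S)
card-lookup []          = refl
card-lookup (true ∷ S)  = cong suc (card-lookup S)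
card-lookup (false ∷ S) = card-lookup S

card-tabulate : ∀ {n} (g : Fin n → Bool) → ∣ tabulate g ∣ ≡ count g
card-tabulate g = trans (card-lookup (tabulate g)) (count-cong (lookup∘tabulate g))

∈-tabulate⁻ : ∀ {n} {g : Fin n → Bool} {x} → x ∈ tabulate g → g x ≡ true
∈-tabulate⁻ {g = g} {x} x∈ = trans (sym (lookup∘tabulate g x)) ([]=⇒lookup x∈)

comparable-sym : ∀ (P : FinPoset) {x y} → Comparable P x y → Comparable P y x
comparable-sym P (inj₁ x≡y)        = inj₁ (sym x≡y)
comparable-sym P (inj₂ (inj₁ x≺y)) = inj₂ (inj₂ x≺y)
comparable-sym P (inj₂ (inj₂ y≺x)) = inj₂ (inj₁ y≺x)

incomparable-sym : ∀ (P : FinPoset) {x y} → Incomparable P x y → Incomparable P y x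
incomparable-sym P x∥y y~x = x∥y (comparable-sym P y~x)

CollectionPair : (P : FinPoset) → Fin (n P) → Fin (n P) → ℕ → ℕ → Set
CollectionPair P x y i j = (i ≡ j → Comparable P x y) × (i ≢ j → Incomparable P x y)

pair-transfer : ∀ (P R : FinPoset) {x y a b i j i′ j′} →
  Comparable R a b ⇔ Comparable P x y → (i′ ≡ j′ ⇔ i ≡ j) →
  CollectionPair P x y i j → CollectionPair R a b i′ j′
pair-transfer P R comparable labels (same , different) =
  (λ eq → from comparable (same (to labels eq))) ,
  (λ neq c → different (λ eq → neq (from labels eq)) (to comparable c))

≡⇔≡ : ∀ {A : Set} {a a′ b b′ : A} → a ≡ a′ → b ≡ b′ → (a ≡ b ⇔ a′ ≡ b′)
≡⇔≡ refl refl = ⇔-refl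

module _ (P : FinPoset) where

  IsChainᵇ : (Fin (n P) → Bool) → Set
  IsChainᵇ H = ∀ x y → H x ≡ true → H y ≡ true → Comparable P x y

  IsCollectionᵇ : (Fin (n P) → Bool) → (Fin (n P) → ℕ) → Set
  IsCollectionᵇ C label = ∀ x y → C x ≡ true → C y ≡ true → CollectionPair P x y (label x) (label y)

  collection-tabulate : ∀ {C label} → IsCollectionᵇ C label → IsChainCollection P (tabulate C) label
  collection-tabulate col x y x∈ y∈ = col x y (∈-tabulate⁻ x∈) (∈-tabulate⁻ y∈)

  count-∨-incomparable : ∀ {C₁ C₂} → (∀ x y → C₁ x ≡ true → C₂ y ≡ true → Incomparable P x y) →
    count (λ x → C₁ x ∨ C₂ x) ≡ count C₁ + count C₂
  count-∨-incomparable {C₁} {C₂} cross = count-∨ C₁ C₂ disjoint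
    where
    disjoint : ∀ x → C₁ x ≡ true → C₂ x ≡ false
    disjoint x c₁x with C₂ x in c₂x
    ... | true  = contradiction (inj₁ refl) (cross x x c₁x c₂x)
    ... | false = refl

  hub⇒chain : ∀ {S label} t → t ∈ S → (∀ z → z ∈ S → Comparable P z t) →
    IsChainCollection P S label → IsChain P S
  hub⇒chain {S} {label} t t∈S hub col x y x∈S y∈S =
    proj₁ (col x y x∈S y∈S) (trans (same-label x x∈S) (sym (same-label y y∈S)))
    where
    same-label : ∀ z → z ∈ S → label z ≡ label t
    same-label z z∈S with label z ≟ label t
    ... | yes eq  = eq
    ... | no  neq = contradiction (hub z z∈S) (proj₂ (col z t z∈S t∈S) neq)

  chain-collection : ∀ {H} → IsChainᵇ H → IsCollectionᵇ H (λ _ → 0)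
  chain-collection chain x y hx hy = (λ _ → chain x y hx hy) , (λ 0≢0 → contradiction refl 0≢0)

  merge-labels : (Fin (n P) → Bool) → (Fin (n P) → ℕ) → (Fin (n P) → ℕ) → Fin (n P) → ℕ
  merge-labels C₁ ℓ₁ ℓ₂ x = if C₁ x then 2 * ℓ₁ x else suc (2 * ℓ₂ x)

  collection-∨ : ∀ {C₁ C₂ ℓ₁ ℓ₂} → IsCollectionᵇ C₁ ℓ₁ → IsCollectionᵇ C₂ ℓ₂ →
    (∀ x y → C₁ x ≡ true → C₂ y ≡ true → Incomparable P x y) →
    IsCollectionᵇ (λ x → C₁ x ∨ C₂ x) (merge-labels C₁ ℓ₁ ℓ₂)
  collection-∨ {C₁} {C₂} {ℓ₁} {ℓ₂} col₁ col₂ cross x y cx cy = cases (side x cx) (side y cy)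
    where
    side : ∀ z → C₁ z ∨ C₂ z ≡ true → C₁ z ≡ true ⊎ (C₁ z ≡ false × C₂ z ≡ true)
    side z cz with C₁ z
    ... | true  = inj₁ refl
    ... | false = inj₂ (refl , cz)
    label : Fin (n P) → ℕ
    label = merge-labels C₁ ℓ₁ ℓ₂
    cases : C₁ x ≡ true ⊎ (C₁ x ≡ false × C₂ x ≡ true) → C₁ y ≡ true ⊎ (C₁ y ≡ false × C₂ y ≡ true) →
      CollectionPair P x y (label x) (label y)
    cases (inj₁ c₁x) (inj₁ c₁y) rewrite c₁x | c₁y =
      (λ eq → proj₁ (col₁ x y c₁x c₁y) (*-cancelˡ-≡ _ _ 2 eq)) ,
      (λ neq → proj₂ (col₁ x y c₁x c₁y) (λ eq → neq (cong (2 *_) eq)))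
    cases (inj₂ (n₁x , c₂x)) (inj₂ (n₁y , c₂y)) rewrite n₁x | n₁y =
      (λ eq → proj₁ (col₂ x y c₂x c₂y) (*-cancelˡ-≡ _ _ 2 (suc-injective eq))) ,
      (λ neq → proj₂ (col₂ x y c₂x c₂y) (λ eq → neq (cong (λ l → suc (2 * l)) eq)))
    cases (inj₁ c₁x) (inj₂ (n₁y , c₂y)) rewrite c₁x | n₁y =
      (λ eq → contradiction eq (even≢odd (ℓ₁ x) (ℓ₂ y))) , (λ _ → cross x y c₁x c₂y)
    cases (inj₂ (n₁x , c₂x)) (inj₁ c₁y) rewrite n₁x | c₁y =
      (λ eq → contradiction (sym eq) (even≢odd (ℓ₁ y) (ℓ₂ x))) ,
      (λ _ comp → cross y x c₁y c₂x (comparable-sym P comp))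

module UpperBound (P : FinPoset) (_⊏?_ : Decidable (_≺_ P)) (vfree : VFree P) where

  private
    N : ℕ
    N = n P
    _⊏_ : Fin N → Fin N → Set
    _⊏_ = _≺_ P
  open IsStrictPartialOrder (isSPO P) using (irrefl) renaming (trans to ⊏-trans)

  _<ᵇ_ : Fin N → Fin N → Bool
  x <ᵇ y = does (x ⊏? y)

  <ᵇ-sound : ∀ {x y} → x <ᵇ y ≡ true → x ⊏ y
  <ᵇ-sound {x} {y} eq with x ⊏? y
  ... | yes x⊏y = x⊏y

  <ᵇ-complete : ∀ {x y} → x ⊏ y → x <ᵇ y ≡ true
  <ᵇ-complete {x} {y} x⊏y with x ⊏? y
  ... | yes _   = refl
  ... | no  x⊀y = contradiction x⊏y x⊀y

  <ᵇ-false : ∀ {x y} → x <ᵇ y ≡ false → ¬ x ⊏ y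
  <ᵇ-false {x} {y} eq with x ⊏? y
  ... | no x⊀y = x⊀y

  Maximal : (Fin N → Bool) → Fin N → Set
  Maximal S r = S r ≡ true × (∀ y → S y ≡ true → ¬ r ⊏ y)

  above : (Fin N → Bool) → Fin N → Fin N → Bool
  above S x y = S y ∧ x <ᵇ y

  -- Every non-empty S has a maximal element: climb to an element above the
  -- current one while there is one; the set of elements above shrinks.
  maximal-element : ∀ k (S : Fin N → Bool) {x} → S x ≡ true → count (above S x) ≤ k → ∃[ r ] Maximal S r
  maximal-element k S {x} Sx bound with nonempty? (above S x)
  ... | inj₂ none = x , Sx , λ y Sy x⊏y → contradiction (trans (sym (∧-intro Sy (<ᵇ-complete x⊏y))) (none y)) λ ()
  maximal-element zero    S Sx bound | inj₁ (y , above-y) = contradiction bound (<⇒≱ (count-pos (above S _) above-y))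
  maximal-element (suc k) S {x} Sx bound | inj₁ (y , above-y) =
    maximal-element k S (∧-conicalˡ _ _ above-y) (≤-pred (≤-trans shrinks bound))
    where
    x⊏y : x ⊏ y
    x⊏y = <ᵇ-sound (∧-conicalʳ _ _ above-y)
    above-y⊆above-x : ∀ z → above S y z ≡ true → above S x z ≡ true
    above-y⊆above-x z yz = ∧-intro (∧-conicalˡ _ _ yz) (<ᵇ-complete (⊏-trans x⊏y (<ᵇ-sound (∧-conicalʳ _ _ yz))))
    y-not-above-y : above S y y ≡ false
    y-not-above-y with y ⊏? y
    ... | yes y⊏y = contradiction y⊏y (irrefl refl)
    ... | no  _   = ∧-zeroʳ (S y)
    shrinks : count (above S y) < count (above S x)
    shrinks = count-< (above S x) (above S y) above-y⊆above-x above-y y-not-above-y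

  -- A certificate for S: a chain collection C and a chain H inside S with
  -- |H| ≤ |C| and |S| + |C| ≤ Λ(|C|) + |H|.  For S = P it gives |P| ≤ Λ(|C|).
  record Certificate (S : Fin N → Bool) : Set where
    field
      C          : Fin N → Bool
      label      : Fin N → ℕ
      H          : Fin N → Bool
      C⊆S        : ∀ x → C x ≡ true → S x ≡ true
      H⊆S        : ∀ x → H x ≡ true → S x ≡ true
      collection : IsCollectionᵇ P C label
      chain      : IsChainᵇ P H
      H≤C        : count H ≤ count C
      bound      : count S + count C ≤ Λ (count C) + count H

  certificate-empty : ∀ S → (∀ x → S x ≡ false) → Certificate S
  certificate-empty S none = record
    { C = nothing ; label = λ _ → 0 ; H = nothing
    ; C⊆S = λ _ () ; H⊆S = λ _ () ; collection = λ _ _ () ; chain = λ _ _ ()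
    ; H≤C = ≤-refl
    ; bound = subst (λ c → count S + c ≤ Λ c + c) (sym (count-none nothing (λ _ → refl)))
                    (≤-reflexive (trans (+-identityʳ (count S)) (count-none S none))) }
    where
    nothing : Fin N → Bool
    nothing _ = false

  -- Joining certificates of two parts of S whose elements are mutually
  -- incomparable: merge the collections and keep the longer chain; the
  -- superadditivity of Λ pays for the shorter chain.
  join-ordered : ∀ S A B → count S ≡ count A + count B →
    (∀ x → A x ≡ true → S x ≡ true) → (∀ x → B x ≡ true → S x ≡ true) →
    (∀ x y → A x ≡ true → B y ≡ true → Incomparable P x y) →
    (cert-A : Certificate A) (cert-B : Certificate B) →
    count (Certificate.H cert-B) ≤ count (Certificate.H cert-A) → Certificate S
  join-ordered S A B |S| A⊆S B⊆S cross cert-A cert-B h₂≤h₁ = record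
    { C = C ; label = merge-labels P C₁ ℓ₁ ℓ₂ ; H = H₁
    ; C⊆S = C⊆S ; H⊆S = λ x hx → A⊆S x (H₁⊆A x hx)
    ; collection = collection-∨ P col₁ col₂ cross′
    ; chain = chain₁
    ; H≤C = subst (count H₁ ≤_) (sym |C|) (≤-trans H₁≤C₁ (m≤m+n (count C₁) (count C₂)))
    ; bound = subst (λ c → count S + c ≤ Λ c + count H₁) (sym |C|) arithmetic }
    where
    open Certificate cert-A renaming (C to C₁; label to ℓ₁; H to H₁; C⊆S to C₁⊆A; H⊆S to H₁⊆A;
                                      collection to col₁; chain to chain₁; H≤C to H₁≤C₁; bound to bound₁)
    open Certificate cert-B renaming (C to C₂; label to ℓ₂; H to H₂; C⊆S to C₂⊆B; H⊆S to H₂⊆B;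
                                      collection to col₂; chain to chain₂; H≤C to H₂≤C₂; bound to bound₂)
    C : Fin N → Bool
    C x = C₁ x ∨ C₂ x
    cross′ : ∀ x y → C₁ x ≡ true → C₂ y ≡ true → Incomparable P x y
    cross′ x y c₁x c₂y = cross x y (C₁⊆A x c₁x) (C₂⊆B y c₂y)
    C⊆S : ∀ x → C x ≡ true → S x ≡ true
    C⊆S x cx with ∨-true (C₁ x) (C₂ x) cx
    ... | inj₁ c₁x = A⊆S x (C₁⊆A x c₁x)
    ... | inj₂ c₂x = B⊆S x (C₂⊆B x c₂x)
    |C| : count C ≡ count C₁ + count C₂
    |C| = count-∨-incomparable P cross′
    arithmetic : count S + (count C₁ + count C₂) ≤ Λ (count C₁ + count C₂) + count H₁
    arithmetic = begin
      count S + (c₁ + c₂)            ≡⟨ cong (_+ (c₁ + c₂)) |S| ⟩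
      (count A + count B) + (c₁ + c₂) ≡⟨ interchange (count A) (count B) c₁ c₂ ⟩
      (count A + c₁) + (count B + c₂) ≤⟨ +-mono-≤ bound₁ bound₂ ⟩
      (Λ c₁ + h₁) + (Λ c₂ + h₂)      ≡⟨ interchange (Λ c₁) h₁ (Λ c₂) h₂ ⟩
      (Λ c₁ + Λ c₂) + (h₁ + h₂)      ≡⟨ x∙yz≈xz∙y (Λ c₁ + Λ c₂) h₁ h₂ ⟩
      Λ c₁ + Λ c₂ + h₂ + h₁          ≤⟨ +-monoˡ-≤ h₁ (Λ-superadditive (≤-trans h₂≤h₁ H₁≤C₁) H₂≤C₂) ⟩
      Λ (c₁ + c₂) + h₁               ∎
      where
      open ≤-Reasoning
      c₁ c₂ h₁ h₂ : ℕ
      c₁ = count C₁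
      c₂ = count C₂
      h₁ = count H₁
      h₂ = count H₂

  certificate-join : ∀ S A B → count S ≡ count A + count B →
    (∀ x → A x ≡ true → S x ≡ true) → (∀ x → B x ≡ true → S x ≡ true) →
    (∀ x y → A x ≡ true → B y ≡ true → Incomparable P x y) →
    Certificate A → Certificate B → Certificate S
  certificate-join S A B |S| A⊆S B⊆S cross cert-A cert-B
    with ≤-total (count (Certificate.H cert-B)) (count (Certificate.H cert-A))
  ... | inj₁ h₂≤h₁ = join-ordered S A B |S| A⊆S B⊆S cross cert-A cert-B h₂≤h₁
  ... | inj₂ h₁≤h₂ = join-ordered S B A (trans |S| (+-comm (count A) (count B))) B⊆S A⊆S
                       (λ x y bx ay → incomparable-sym P (cross y x ay bx)) cert-B cert-A h₁≤h₂

  chain-extend : ∀ {H r} → (∀ x → H x ≡ true → x ⊏ r) → IsChainᵇ P H →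
    IsChainᵇ P (λ x → H x ∨ single r x) × count (λ x → H x ∨ single r x) ≡ count H + 1
  chain-extend {H} {r} H⊏r chain = chain′ , trans (count-∨ H (single r) r∉H) (cong (count H +_) (count-single r))
    where
    r∉H : ∀ x → H x ≡ true → single r x ≡ false
    r∉H x hx with single r x in eq
    ... | true  = contradiction (H⊏r x hx) (irrefl (single-true eq))
    ... | false = refl
    below-r : ∀ {x y} → H x ≡ true → single r y ≡ true → x ⊏ y
    below-r {x} hx y=r = subst (x ⊏_) (sym (single-true y=r)) (H⊏r x hx)
    chain′ : IsChainᵇ P (λ x → H x ∨ single r x)
    chain′ x y hx hy with ∨-true (H x) (single r x) hx | ∨-true (H y) (single r y) hy
    ... | inj₁ hx′ | inj₁ hy′ = chain x y hx′ hy′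
    ... | inj₁ hx′ | inj₂ y=r = inj₂ (inj₁ (below-r hx′ y=r))
    ... | inj₂ x=r | inj₁ hy′ = inj₂ (inj₂ (below-r hy′ x=r))
    ... | inj₂ x=r | inj₂ y=r = inj₁ (trans (single-true x=r) (sym (single-true y=r)))

  -- Adding a top element r above a part D: r extends the chain H; if H was
  -- already as large as C, the extended chain becomes the new collection
  -- (this uses Λ(h) + 1 ≤ Λ(h + 1)).
  certificate-extend : ∀ S D r → count S ≡ count D + 1 → S r ≡ true →
    (∀ x → D x ≡ true → S x ≡ true) → (∀ x → D x ≡ true → x ⊏ r) →
    Certificate D → Certificate S
  certificate-extend S D r |S| Sr D⊆S D⊏r cert = choose (m≤n⇒m<n∨m≡n H≤C)
    where
    open Certificate cert
    H′ : Fin N → Bool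
    H′ x = H x ∨ single r x
    extended : IsChainᵇ P H′ × count H′ ≡ count H + 1
    extended = chain-extend {H} {r} (λ x hx → D⊏r x (H⊆S x hx)) chain
    chain′ : IsChainᵇ P H′
    chain′ = proj₁ extended
    |H′| : count H′ ≡ count H + 1
    |H′| = proj₂ extended
    H′⊆S : ∀ x → H′ x ≡ true → S x ≡ true
    H′⊆S x hx with ∨-true (H x) (single r x) hx
    ... | inj₁ hx′ = D⊆S x (H⊆S x hx′)
    ... | inj₂ x=r = subst (λ y → S y ≡ true) (sym (single-true x=r)) Sr
    choose : count H < count C ⊎ count H ≡ count C → Certificate S
    choose (inj₁ h<c) = record
      { C = C ; label = label ; H = H′
      ; C⊆S = λ x cx → D⊆S x (C⊆S x cx) ; H⊆S = H′⊆S
      ; collection = collection ; chain = chain′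
      ; H≤C = subst (_≤ count C) (trans (+-comm 1 (count H)) (sym |H′|)) h<c
      ; bound = subst (λ h → count S + count C ≤ Λ (count C) + h) (sym |H′|) (begin
          count S + count C            ≡⟨ cong (_+ count C) |S| ⟩
          count D + 1 + count C        ≡⟨ xy∙z≈xz∙y (count D) 1 (count C) ⟩
          count D + count C + 1        ≤⟨ +-monoˡ-≤ 1 bound ⟩
          Λ (count C) + count H + 1    ≡⟨ +-assoc (Λ (count C)) (count H) 1 ⟩
          Λ (count C) + (count H + 1)  ∎) }
      where open ≤-Reasoning
    choose (inj₂ h≡c) = record
      { C = H′ ; label = λ _ → 0 ; H = H′
      ; C⊆S = H′⊆S ; H⊆S = H′⊆S
      ; collection = chain-collection P chain′ ; chain = chain′
      ; H≤C = ≤-refl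
      ; bound = +-monoˡ-≤ (count H′) (begin
          count S                ≡⟨ |S| ⟩
          count D + 1            ≤⟨ +-monoˡ-≤ 1 |D|≤Λh ⟩
          Λ (count H) + 1        ≡⟨ +-comm (Λ (count H)) 1 ⟩
          suc (Λ (count H))      ≤⟨ Λ-increasing (count H) ⟩
          Λ (suc (count H))      ≡⟨ cong Λ (trans (+-comm 1 (count H)) (sym |H′|)) ⟩
          Λ (count H′)           ∎) }
      where
      open ≤-Reasoning
      |D|≤Λh : count D ≤ Λ (count H)
      |D|≤Λh = +-cancelʳ-≤ (count H) (count D) (Λ (count H))
                 (subst (λ c → count D + c ≤ Λ c + count H) (sym h≡c) bound)

  below-maximal-incomparable : ∀ {S r x y} → Maximal S r → x ⊏ r ⊎ x ≡ r →
    S y ≡ true → ¬ y ⊏ r → y ≢ r → Incomparable P x y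
  below-maximal-incomparable _ x≼r _ y⊀r y≢r (inj₁ refl) = [ y⊀r , y≢r ] x≼r
  below-maximal-incomparable _ (inj₁ x⊏r) _ y⊀r _ (inj₂ (inj₂ y⊏x)) = y⊀r (⊏-trans y⊏x x⊏r)
  below-maximal-incomparable _ (inj₂ refl) _ y⊀r _ (inj₂ (inj₂ y⊏r)) = y⊀r y⊏r
  below-maximal-incomparable (_ , r-max) (inj₂ refl) Sy _ _ (inj₂ (inj₁ r⊏y)) = r-max _ Sy r⊏y
  below-maximal-incomparable {r = r} {y = y} (_ , r-max) (inj₁ x⊏r) Sy y⊀r y≢r (inj₂ (inj₁ x⊏y)) =
    vfree _ y r x⊏y x⊏r y∥r
    where
    y∥r : Incomparable P y r
    y∥r (inj₁ y≡r)        = y≢r y≡r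
    y∥r (inj₂ (inj₁ y⊏r)) = y⊀r y⊏r
    y∥r (inj₂ (inj₂ r⊏y)) = r-max y Sy r⊏y

  module Decomposition (S : Fin N → Bool) (r : Fin N) (r-max : Maximal S r) where

    atMost : Fin N → Bool
    atMost y = y <ᵇ r ∨ single r y

    D A E : Fin N → Bool
    D y = S y ∧ y <ᵇ r
    A y = S y ∧ atMost y
    E y = S y ∧ not (atMost y)

    |S| : count S ≡ count A + count E
    |S| = count-split S atMost

    A-is-D+r : ∀ y → A y ≡ (D y ∨ single r y)
    A-is-D+r y with single r y in eq
    ... | true  = trans (cong (_∧ (y <ᵇ r ∨ true)) Sy) (trans (∨-zeroʳ (y <ᵇ r)) (sym (∨-zeroʳ (D y))))
      where
      Sy : S y ≡ true
      Sy = subst (λ z → S z ≡ true) (sym (single-true eq)) (proj₁ r-max)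
    ... | false = trans (cong (S y ∧_) (∨-identityʳ (y <ᵇ r))) (sym (∨-identityʳ (D y)))

    r∉D : ∀ y → D y ≡ true → single r y ≡ false
    r∉D y dy with single r y in eq
    ... | true  = contradiction (<ᵇ-sound (∧-conicalʳ _ _ dy)) (irrefl (single-true eq))
    ... | false = refl

    |A| : count A ≡ count D + 1
    |A| = trans (count-cong A-is-D+r) (trans (count-∨ D (single r) r∉D) (cong (count D +_) (count-single r)))

    Ar : A r ≡ true
    Ar = trans (A-is-D+r r) (trans (cong (D r ∨_) (single-self r)) (∨-zeroʳ (D r)))

    D⊆A : ∀ y → D y ≡ true → A y ≡ true
    D⊆A y dy = trans (A-is-D+r y) (∨-introˡ (single r y) dy)

    D⊏r : ∀ y → D y ≡ true → y ⊏ r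
    D⊏r y dy = <ᵇ-sound (∧-conicalʳ _ _ dy)

    A⊆S : ∀ y → A y ≡ true → S y ≡ true
    A⊆S y ay = ∧-conicalˡ _ _ ay

    E⊆S : ∀ y → E y ≡ true → S y ≡ true
    E⊆S y ey = ∧-conicalˡ _ _ ey

    A∥E : ∀ x y → A x ≡ true → E y ≡ true → Incomparable P x y
    A∥E x y ax ey = below-maximal-incomparable r-max x≼r (E⊆S y ey) (<ᵇ-false y<r) y≢r
      where
      x≼r : x ⊏ r ⊎ x ≡ r
      x≼r with ∨-true (x <ᵇ r) (single r x) (∧-conicalʳ _ _ ax)
      ... | inj₁ x<r = inj₁ (<ᵇ-sound x<r)
      ... | inj₂ x=r = inj₂ (single-true x=r)
      y≰r : atMost y ≡ false
      y≰r = not-true (∧-conicalʳ _ _ ey)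
      y<r : y <ᵇ r ≡ false
      y<r = ∨-conicalˡ _ _ y≰r
      y≢r : y ≢ r
      y≢r refl = contradiction (trans (sym (single-self r)) (∨-conicalʳ _ _ y≰r)) λ ()

    D-smaller : count D < count S
    D-smaller = begin-strict
      count D              <⟨ m<m+n (count D) (s≤s z≤n) ⟩
      count D + 1          ≡⟨ |A| ⟨
      count A              ≤⟨ m≤m+n (count A) (count E) ⟩
      count A + count E    ≡⟨ |S| ⟨
      count S              ∎
      where open ≤-Reasoning

    E-smaller : count E < count S
    E-smaller = subst (count E <_) (sym |S|) (m<n+m (count E) (count-pos A Ar))

  certificate : ∀ k S → count S ≤ k → Certificate S
  certificate k S |S|≤k with nonempty? S
  ... | inj₂ none = certificate-empty S none
  certificate zero    S |S|≤0   | inj₁ (x , Sx) = contradiction |S|≤0 (<⇒≱ (count-pos S Sx))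
  certificate (suc k) S |S|≤1+k | inj₁ (x , Sx) with maximal-element N S Sx (count-≤ (above S x))
  ... | r , r-max = certificate-join S A E |S| A⊆S E⊆S A∥E
                      (certificate-extend A D r |A| Ar D⊆A D⊏r (certificate k D (smaller D-smaller)))
                      (certificate k E (smaller E-smaller))
    where
    open Decomposition S r r-max
    smaller : ∀ {t} → t < count S → t ≤ k
    smaller t<|S| = ≤-pred (≤-trans t<|S| |S|≤1+k)

  size-bound : ∀ {a} → AoEq P a → N ≤ Λ a
  size-bound {a} (_ , maximum) = begin
    N             ≤⟨ N≤Λ|C| ⟩
    Λ (count C)   ≤⟨ Λ-monotone |C|≤a ⟩
    Λ a           ∎
    where
    open ≤-Reasoning
    open Certificate (certificate N (λ _ → true) (count-≤ (λ _ → true)))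
    |C|≤a : count C ≤ a
    |C|≤a = subst (_≤ a) (card-tabulate C) (maximum (tabulate C) label (collection-tabulate P collection))
    N≤Λ|C| : N ≤ Λ (count C)
    N≤Λ|C| = +-cancelʳ-≤ (count C) N (Λ (count C)) (begin
      N + count C                          ≡⟨ cong (_+ count C) (count-all N) ⟨
      count {N} (λ _ → true) + count C     ≤⟨ bound ⟩
      Λ (count C) + count H                ≤⟨ +-monoʳ-≤ (Λ (count C)) H≤C ⟩
      Λ (count C) + count C                ∎)

¬¬-∀-Fin : ∀ {m} {Q : Fin m → Set} → (∀ i → ¬ ¬ Q i) → ¬ ¬ (∀ i → Q i)
¬¬-∀-Fin {zero}      _    k = k (λ ())
¬¬-∀-Fin {suc m} {Q} ¬¬Q k =
  ¬¬Q zero λ q₀ → ¬¬-∀-Fin (λ i → ¬¬Q (suc i)) λ qₛ → k λ { zero → q₀ ; (suc i) → qₛ i }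

upper-bound : ∀ (P : FinPoset) → VFree P → ∀ {a} → AoEq P a → size P ≤ Λ a
upper-bound P vfree {a} ao = decidable-stable (n P ≤? Λ a) λ ¬bound →
  ¬¬-∀-Fin (λ x → ¬¬-∀-Fin (λ y → ¬¬-excluded-middle))
    λ _≺?_ → ¬bound (UpperBound.size-bound P _≺?_ vfree ao)

-- Gluing P and Q side by side on Fin (m + k): P on the first block, Q on the
-- second, and p ≺ q for p in P and q in Q exactly when Link holds.
-- Link = ⊥ gives the disjoint union, Link = ⊤ the ordinal sum (Q on top).
module Glue (P Q : FinPoset) (Link : Set) where

  private
    m k : ℕ
    m = n P
    k = n Q
    module P = IsStrictPartialOrder (isSPO P)
    module Q = IsStrictPartialOrder (isSPO Q)

  _⊏_ : Fin m ⊎ Fin k → Fin m ⊎ Fin k → Set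
  inj₁ x ⊏ inj₁ y = _≺_ P x y
  inj₁ _ ⊏ inj₂ _ = Link
  inj₂ _ ⊏ inj₁ _ = ⊥
  inj₂ x ⊏ inj₂ y = _≺_ Q x y

  ⊏-irrefl : ∀ u → ¬ u ⊏ u
  ⊏-irrefl (inj₁ x) = P.irrefl refl
  ⊏-irrefl (inj₂ y) = Q.irrefl refl

  ⊏-trans : ∀ u v w → u ⊏ v → v ⊏ w → u ⊏ w
  ⊏-trans (inj₁ x) (inj₁ y) (inj₁ z) x≺y y≺z = P.trans x≺y y≺z
  ⊏-trans (inj₁ x) (inj₁ y) (inj₂ z) _   link = link
  ⊏-trans (inj₁ x) (inj₂ y) (inj₂ z) link _   = link
  ⊏-trans (inj₂ x) (inj₂ y) (inj₂ z) x≺y y≺z = Q.trans x≺y y≺z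

  glued : FinPoset
  glued = record
    { n     = m + k
    ; _≺_   = λ x y → splitAt m x ⊏ splitAt m y
    ; isSPO = record
      { isEquivalence = isEquivalence
      ; irrefl        = λ { {x} refl → ⊏-irrefl (splitAt m x) }
      ; trans         = λ {x} {y} {z} → ⊏-trans (splitAt m x) (splitAt m y) (splitAt m z)
      ; <-resp-≈      = (λ { refl r → r }) , (λ { refl r → r }) } }

  Comparable⊎ : Fin m ⊎ Fin k → Fin m ⊎ Fin k → Set
  Comparable⊎ u w = u ≡ w ⊎ u ⊏ w ⊎ w ⊏ u

  comparable-splitAt : ∀ {x y} → Comparable glued x y ⇔ Comparable⊎ (splitAt m x) (splitAt m y)
  comparable-splitAt {x} {y} = mk⇔ forth back
    where
    forth : Comparable glued x y → Comparable⊎ (splitAt m x) (splitAt m y)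
    forth (inj₁ refl) = inj₁ refl
    forth (inj₂ r)    = inj₂ r
    back : Comparable⊎ (splitAt m x) (splitAt m y) → Comparable glued x y
    back (inj₁ eq) = inj₁ (trans (sym (join-splitAt m k x)) (trans (cong (join m k) eq) (join-splitAt m k y)))
    back (inj₂ r)  = inj₂ r

  comparable-join : ∀ u w → Comparable glued (join m k u) (join m k w) ⇔ Comparable⊎ u w
  comparable-join u w = mk⇔
    (λ c → subst₂ Comparable⊎ (splitAt-join m k u) (splitAt-join m k w) (to comparable-splitAt c))
    (λ c → from comparable-splitAt (subst₂ Comparable⊎ (sym (splitAt-join m k u)) (sym (splitAt-join m k w)) c))

  inj₁-comparable : ∀ {x y} → Comparable⊎ (inj₁ x) (inj₁ y) ⇔ Comparable P x y
  inj₁-comparable = mk⇔ (λ { (inj₁ refl) → inj₁ refl ; (inj₂ r) → inj₂ r })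
                        (λ { (inj₁ refl) → inj₁ refl ; (inj₂ r) → inj₂ r })

  inj₂-comparable : ∀ {x y} → Comparable⊎ (inj₂ x) (inj₂ y) ⇔ Comparable Q x y
  inj₂-comparable = mk⇔ (λ { (inj₁ refl) → inj₁ refl ; (inj₂ r) → inj₂ r })
                        (λ { (inj₁ refl) → inj₁ refl ; (inj₂ r) → inj₂ r })

  comparable-left : ∀ {x y} → Comparable glued (x ↑ˡ k) (y ↑ˡ k) ⇔ Comparable P x y
  comparable-left {x} {y} = ⇔-trans (comparable-join (inj₁ x) (inj₁ y)) inj₁-comparable

  comparable-right : ∀ {x y} → Comparable glued (m ↑ʳ x) (m ↑ʳ y) ⇔ Comparable Q x y
  comparable-right {x} {y} = ⇔-trans (comparable-join (inj₂ x) (inj₂ y)) inj₂-comparable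

  comparable-cross : ∀ {x y} → Comparable glued (x ↑ˡ k) (m ↑ʳ y) ⇔ Link
  comparable-cross {x} {y} = mk⇔
    (λ c → lower (to (comparable-join (inj₁ x) (inj₂ y)) c))
    (λ link → from (comparable-join (inj₁ x) (inj₂ y)) (inj₂ (inj₁ link)))
    where
    lower : Comparable⊎ (inj₁ x) (inj₂ y) → Link
    lower (inj₂ (inj₁ link)) = link

  data Block : Fin (m + k) → Set where
    left  : ∀ x → Block (x ↑ˡ k)
    right : ∀ y → Block (m ↑ʳ y)

  block : ∀ z → Block z
  block z with splitAt m z in eq
  ... | inj₁ x = subst Block (splitAt⁻¹-↑ˡ eq) (left x)
  ... | inj₂ y = subst Block (splitAt⁻¹-↑ʳ eq) (right y)

  vfree⊎ : VFree P → VFree Q → (Link → ∀ y y′ → Comparable Q y y′) →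
    ∀ u v w → u ⊏ v → u ⊏ w → ¬ ¬ Comparable⊎ v w
  vfree⊎ vP _  _     (inj₁ x) (inj₁ y) (inj₁ z) x≺y x≺z ¬c = vP x y z x≺y x≺z (λ c → ¬c (from inj₁-comparable c))
  vfree⊎ _  _  _     (inj₁ _) (inj₁ _) (inj₂ _) _   link ¬c = ¬c (inj₂ (inj₁ link))
  vfree⊎ _  _  _     (inj₁ _) (inj₂ _) (inj₁ _) link _   ¬c = ¬c (inj₂ (inj₂ link))
  vfree⊎ _  _  total (inj₁ _) (inj₂ y) (inj₂ z) link _   ¬c = ¬c (from inj₂-comparable (total link y z))
  vfree⊎ _  vQ _     (inj₂ x) (inj₂ y) (inj₂ z) x≺y x≺z ¬c = vQ x y z x≺y x≺z (λ c → ¬c (from inj₂-comparable c))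

  glued-vfree : VFree P → VFree Q → (Link → ∀ y y′ → Comparable Q y y′) → VFree glued
  glued-vfree vP vQ total p₁ p₂ p₃ p₁≺p₂ p₁≺p₃ p₂∥p₃ =
    vfree⊎ vP vQ total (splitAt m p₁) (splitAt m p₂) (splitAt m p₃) p₁≺p₂ p₁≺p₃
      (λ c → p₂∥p₃ (from comparable-splitAt c))

  leftPart : Subset (m + k) → Subset m
  leftPart S = tabulate (λ x → lookup S (x ↑ˡ k))

  rightPart : Subset (m + k) → Subset k
  rightPart S = tabulate (λ y → lookup S (m ↑ʳ y))

  card-parts : ∀ S → ∣ S ∣ ≡ ∣ leftPart S ∣ + ∣ rightPart S ∣
  card-parts S = begin
    ∣ S ∣                             ≡⟨ card-lookup S ⟩
    count (lookup S)                  ≡⟨ count-++ m (lookup S) ⟩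
    count inLeft + count inRight      ≡⟨ cong₂ _+_ (card-tabulate inLeft) (card-tabulate inRight) ⟨
    ∣ leftPart S ∣ + ∣ rightPart S ∣  ∎
    where
    open ≡-Reasoning
    inLeft : Fin m → Bool
    inLeft x = lookup S (x ↑ˡ k)
    inRight : Fin k → Bool
    inRight y = lookup S (m ↑ʳ y)

  leftPart-empty : ∀ S → (∀ x → lookup S (x ↑ˡ k) ≡ false) → ∣ leftPart S ∣ ≡ 0
  leftPart-empty S none = trans (card-tabulate (λ x → lookup S (x ↑ˡ k))) (count-none _ none)

  rightPart-empty : ∀ S → (∀ y → lookup S (m ↑ʳ y) ≡ false) → ∣ rightPart S ∣ ≡ 0
  rightPart-empty S none = trans (card-tabulate (λ y → lookup S (m ↑ʳ y))) (count-none _ none)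

  ∈-leftPart : ∀ {S x} → x ∈ leftPart S → (x ↑ˡ k) ∈ S
  ∈-leftPart x∈ = lookup⇒∈ (∈-tabulate⁻ x∈)

  ∈-rightPart : ∀ {S y} → y ∈ rightPart S → (m ↑ʳ y) ∈ S
  ∈-rightPart y∈ = lookup⇒∈ (∈-tabulate⁻ y∈)

  chain-left : ∀ {S} → IsChain glued S → IsChain P (leftPart S)
  chain-left chain x y x∈ y∈ = to comparable-left (chain _ _ (∈-leftPart x∈) (∈-leftPart y∈))

  chain-right : ∀ {S} → IsChain glued S → IsChain Q (rightPart S)
  chain-right chain x y x∈ y∈ = to comparable-right (chain _ _ (∈-rightPart x∈) (∈-rightPart y∈))

  collection-left : ∀ {S ℓ} → IsChainCollection glued S ℓ → IsChainCollection P (leftPart S) (λ x → ℓ (x ↑ˡ k))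
  collection-left col x y x∈ y∈ = pair-transfer glued P (⇔-sym comparable-left) ⇔-refl (col _ _ (∈-leftPart x∈) (∈-leftPart y∈))

  collection-right : ∀ {S ℓ} → IsChainCollection glued S ℓ → IsChainCollection Q (rightPart S) (λ y → ℓ (m ↑ʳ y))
  collection-right col x y x∈ y∈ = pair-transfer glued Q (⇔-sym comparable-right) ⇔-refl (col _ _ (∈-rightPart x∈) (∈-rightPart y∈))

  glued-height : ∀ {h₁ h₂} → HeightLe P h₁ → HeightLe Q h₂ → HeightLe glued (h₁ + h₂)
  glued-height hP hQ S chain =
    subst (_≤ _) (sym (card-parts S)) (+-mono-≤ (hP _ (chain-left chain)) (hQ _ (chain-right chain)))

  glued-collection-size : ∀ {a b} → (∀ S ℓ → IsChainCollection P S ℓ → ∣ S ∣ ≤ a) →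
    (∀ S ℓ → IsChainCollection Q S ℓ → ∣ S ∣ ≤ b) → ∀ S ℓ → IsChainCollection glued S ℓ → ∣ S ∣ ≤ a + b
  glued-collection-size boundP boundQ S ℓ col = subst (_≤ _) (sym (card-parts S))
    (+-mono-≤ (boundP _ _ (collection-left col)) (boundQ _ _ (collection-right col)))

  at-left : ∀ {A : Set} (f : Fin m → A) (g : Fin k → A) x → [ f , g ]′ (splitAt m (x ↑ˡ k)) ≡ f x
  at-left f g x = cong [ f , g ]′ (splitAt-↑ˡ m x k)

  at-right : ∀ {A : Set} (f : Fin m → A) (g : Fin k → A) y → [ f , g ]′ (splitAt m (m ↑ʳ y)) ≡ g y
  at-right f g y = cong [ f , g ]′ (splitAt-↑ʳ m k y)

  liftˡ : Subset m → Fin (m + k) → Bool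
  liftˡ S z = [ lookup S , (λ _ → false) ]′ (splitAt m z)

  liftʳ : Subset k → Fin (m + k) → Bool
  liftʳ S z = [ (λ _ → false) , lookup S ]′ (splitAt m z)

  labelˡ : (Fin m → ℕ) → Fin (m + k) → ℕ
  labelˡ ℓ z = [ ℓ , (λ _ → 0) ]′ (splitAt m z)

  labelʳ : (Fin k → ℕ) → Fin (m + k) → ℕ
  labelʳ ℓ z = [ (λ _ → 0) , ℓ ]′ (splitAt m z)

  count-liftˡ : ∀ S → count (liftˡ S) ≡ ∣ S ∣
  count-liftˡ S = begin
    count (liftˡ S)                                                         ≡⟨ count-++ m (liftˡ S) ⟩
    count (λ x → liftˡ S (x ↑ˡ k)) + count (λ y → liftˡ S (m ↑ʳ y))         ≡⟨ cong₂ _+_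
                                          (count-cong (at-left (lookup S) _))
                                          (count-none _ (at-right (lookup S) _)) ⟩
    count (lookup S) + 0                                                    ≡⟨ +-identityʳ _ ⟩
    count (lookup S)                                                        ≡⟨ card-lookup S ⟨
    ∣ S ∣                                                                   ∎
    where open ≡-Reasoning

  count-liftʳ : ∀ S → count (liftʳ S) ≡ ∣ S ∣
  count-liftʳ S = begin
    count (liftʳ S)                                                         ≡⟨ count-++ m (liftʳ S) ⟩
    count (λ x → liftʳ S (x ↑ˡ k)) + count (λ y → liftʳ S (m ↑ʳ y))         ≡⟨ cong₂ _+_
                                          (count-none _ (at-left _ (lookup S)))
                                          (count-cong (at-right _ (lookup S))) ⟩
    count (lookup S)                                                        ≡⟨ card-lookup S ⟨
    ∣ S ∣                                                                   ∎
    where open ≡-Reasoning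

  collection-liftˡ : ∀ {S ℓ} → IsChainCollection P S ℓ → IsCollectionᵇ glued (liftˡ S) (labelˡ ℓ)
  collection-liftˡ {S} {ℓ} col z w lz lw with block z | block w
  ... | left x  | left y  = pair-transfer P glued comparable-left (≡⇔≡ (at-left ℓ _ x) (at-left ℓ _ y))
                              (col x y (lookup⇒∈ (trans (sym (at-left (lookup S) _ x)) lz))
                                       (lookup⇒∈ (trans (sym (at-left (lookup S) _ y)) lw)))
  ... | left _  | right y = contradiction (trans (sym lw) (at-right (lookup S) _ y)) λ ()
  ... | right x | _       = contradiction (trans (sym lz) (at-right (lookup S) _ x)) λ ()

  collection-liftʳ : ∀ {S ℓ} → IsChainCollection Q S ℓ → IsCollectionᵇ glued (liftʳ S) (labelʳ ℓ)
  collection-liftʳ {S} {ℓ} col z w lz lw with block z | block w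
  ... | right x | right y = pair-transfer Q glued comparable-right (≡⇔≡ (at-right _ ℓ x) (at-right _ ℓ y))
                              (col x y (lookup⇒∈ (trans (sym (at-right _ (lookup S) x)) lz))
                                       (lookup⇒∈ (trans (sym (at-right _ (lookup S) y)) lw)))
  ... | right _ | left y  = contradiction (trans (sym lw) (at-left _ (lookup S) y)) λ ()
  ... | left x  | _       = contradiction (trans (sym lz) (at-left _ (lookup S) x)) λ ()

  lifts-incomparable : ∀ {S₁ S₂} → ¬ Link → ∀ z w → liftˡ S₁ z ≡ true → liftʳ S₂ w ≡ true → Incomparable glued z w
  lifts-incomparable {S₁} {S₂} ¬link z w lz lw with block z | block w
  ... | left _  | right _ = λ c → ¬link (to comparable-cross c)
  ... | left _  | left y  = contradiction (trans (sym lw) (at-left _ (lookup S₂) y)) λ ()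
  ... | right x | _       = contradiction (trans (sym lz) (at-right (lookup S₁) _ x)) λ ()

Total : FinPoset → Set
Total P = ∀ x y → Comparable P x y

total⇒vfree : ∀ P → Total P → VFree P
total⇒vfree P total _ p₂ p₃ _ _ p₂∥p₃ = p₂∥p₃ (total p₂ p₃)

height-mono : ∀ {P h h′} → h ≤ h′ → HeightLe P h → HeightLe P h′
height-mono h≤h′ heightP S isChain = ≤-trans (heightP S isChain) h≤h′

chain : ℕ → FinPoset
chain c = record { n = c ; _≺_ = _<ᶠ_ ; isSPO = <-isStrictPartialOrder }

chain-total : ∀ c → Total (chain c)
chain-total c x y with <-cmp x y
... | tri< x<y _ _ = inj₂ (inj₁ x<y)
... | tri≈ _ x≡y _ = inj₁ x≡y
... | tri> _ _ y<x = inj₂ (inj₂ y<x)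

chain-height : ∀ c → HeightLe (chain c) c
chain-height c S _ = ∣p∣≤n S

chain-ao : ∀ c → AoEq (chain c) c
chain-ao c = (everything , (λ _ → 0) , one-chain , ∣⊤∣≡n c) , (λ S _ _ → ∣p∣≤n S)
  where
  one-chain : IsChainCollection (chain c) everything (λ _ → 0)
  one-chain x y _ _ = (λ _ → chain-total c x y) , (λ 0≢0 → contradiction refl 0≢0)

_∥_ : FinPoset → FinPoset → FinPoset
P ∥ Q = Glue.glued P Q ⊥

∥-vfree : ∀ {P Q} → VFree P → VFree Q → VFree (P ∥ Q)
∥-vfree {P} {Q} vP vQ = Glue.glued-vfree P Q ⊥ vP vQ (λ ())

-- A chain of P ∥ Q lies in one of the two parts.
∥-height : ∀ {P Q h} → HeightLe P h → HeightLe Q h → HeightLe (P ∥ Q) h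
∥-height {P} {Q} {h} hP hQ S isChain with nonempty? (λ x → lookup S (x ↑ˡ n Q))
... | inj₂ none = begin
  ∣ S ∣                            ≡⟨ card-parts S ⟩
  ∣ leftPart S ∣ + ∣ rightPart S ∣  ≡⟨ cong (_+ ∣ rightPart S ∣) (leftPart-empty S none) ⟩
  ∣ rightPart S ∣                  ≤⟨ hQ _ (chain-right isChain) ⟩
  h                                ∎
  where open Glue P Q ⊥ ; open ≤-Reasoning
... | inj₁ (x , x∈S) = begin
  ∣ S ∣                            ≡⟨ card-parts S ⟩
  ∣ leftPart S ∣ + ∣ rightPart S ∣  ≡⟨ cong (∣ leftPart S ∣ +_) (rightPart-empty S right-empty) ⟩
  ∣ leftPart S ∣ + 0               ≡⟨ +-identityʳ ∣ leftPart S ∣ ⟩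
  ∣ leftPart S ∣                   ≤⟨ hP _ (chain-left isChain) ⟩
  h                                ∎
  where
  open Glue P Q ⊥
  open ≤-Reasoning
  right-empty : ∀ y → lookup S (n P ↑ʳ y) ≡ false
  right-empty y with lookup S (n P ↑ʳ y) in y∈S
  ... | true  = contradiction (to comparable-cross (isChain _ _ (lookup⇒∈ x∈S) (lookup⇒∈ y∈S))) λ ()
  ... | false = refl

∥-ao : ∀ {P Q a b} → AoEq P a → AoEq Q b → AoEq (P ∥ Q) (a + b)
∥-ao {P} {Q} {a} {b} ((S₁ , ℓ₁ , col₁ , |S₁|) , maxP) ((S₂ , ℓ₂ , col₂ , |S₂|) , maxQ) =
  (tabulate C , merge-labels glued (liftˡ S₁) (labelˡ ℓ₁) (labelʳ ℓ₂) ,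
   collection-tabulate glued (collection-∨ glued (collection-liftˡ col₁) (collection-liftʳ col₂) cross) ,
   |C|) ,
  glued-collection-size maxP maxQ
  where
  open Glue P Q ⊥
  C : Fin (n P + n Q) → Bool
  C z = liftˡ S₁ z ∨ liftʳ S₂ z
  cross : ∀ z w → liftˡ S₁ z ≡ true → liftʳ S₂ w ≡ true → Incomparable glued z w
  cross = lifts-incomparable {S₁} {S₂} (λ ())
  |C| : ∣ tabulate C ∣ ≡ a + b
  |C| = begin
    ∣ tabulate C ∣                      ≡⟨ card-tabulate C ⟩
    count C                             ≡⟨ count-∨-incomparable glued cross ⟩
    count (liftˡ S₁) + count (liftʳ S₂)  ≡⟨ cong₂ _+_ (trans (count-liftˡ S₁) |S₁|) (trans (count-liftʳ S₂) |S₂|) ⟩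
    a + b                               ∎
    where open ≡-Reasoning

_⊕_ : FinPoset → FinPoset → FinPoset
P ⊕ Q = Glue.glued P Q Unit

⊕-vfree : ∀ {P Q} → VFree P → Total Q → VFree (P ⊕ Q)
⊕-vfree {P} {Q} vP total = Glue.glued-vfree P Q Unit vP (total⇒vfree Q total) (λ _ → total)

⊕-height : ∀ {P Q h₁ h₂} → HeightLe P h₁ → HeightLe Q h₂ → HeightLe (P ⊕ Q) (h₁ + h₂)
⊕-height {P} {Q} = Glue.glued-height P Q Unit

-- Putting a totally ordered Q on top does not change ao(P) as long as the
-- height stays at most ao(P): a collection meeting Q is a single chain.
⊕-ao : ∀ {P Q a h} → AoEq P a → Total Q → HeightLe (P ⊕ Q) h → h ≤ a → AoEq (P ⊕ Q) a
⊕-ao {P} {Q} {a} {h} ((S₁ , ℓ₁ , col₁ , |S₁|) , maxP) total heightR h≤a =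
  (tabulate (liftˡ S₁) , labelˡ ℓ₁ , collection-tabulate glued (collection-liftˡ col₁) ,
   trans (card-tabulate (liftˡ S₁)) (trans (count-liftˡ S₁) |S₁|)) ,
  maximum
  where
  open Glue P Q Unit
  maximum : ∀ S ℓ → IsChainCollection glued S ℓ → ∣ S ∣ ≤ a
  maximum S ℓ col with nonempty? (λ y → lookup S (n P ↑ʳ y))
  ... | inj₁ (y , t∈S) = ≤-trans (heightR S (hub⇒chain glued _ (lookup⇒∈ t∈S) below-t col)) h≤a
    where
    below-t : ∀ z → z ∈ S → Comparable glued z (n P ↑ʳ y)
    below-t z _ with block z
    ... | left x   = from comparable-cross tt
    ... | right y′ = from comparable-right (total y′ y)
  ... | inj₂ none = begin
    ∣ S ∣                            ≡⟨ card-parts S ⟩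
    ∣ leftPart S ∣ + ∣ rightPart S ∣  ≡⟨ cong (∣ leftPart S ∣ +_) (rightPart-empty S none) ⟩
    ∣ leftPart S ∣ + 0               ≡⟨ +-identityʳ ∣ leftPart S ∣ ⟩
    ∣ leftPart S ∣                   ≤⟨ maxP _ _ (collection-left col) ⟩
    a                                ∎
    where open ≤-Reasoning

Realises : ℕ → ℕ → Set₁
Realises b s = Σ FinPoset λ P → VFree P × AoEq P b × HeightLe P b × size P ≡ s

construction : ∀ {f g s t} → g ≤ f → Realises f s → Realises g t → Realises (f + g) (s + t + g)
construction {f} {g} g≤f (P , vfreeP , aoP , heightP , refl) (Q , vfreeQ , aoQ , heightQ , refl) =
  (P ∥ Q) ⊕ chain g ,
  ⊕-vfree (∥-vfree vfreeP vfreeQ) (chain-total g) ,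
  ⊕-ao (∥-ao aoP aoQ) (chain-total g) height ≤-refl ,
  height ,
  refl
  where
  height : HeightLe ((P ∥ Q) ⊕ chain g) (f + g)
  height = ⊕-height (∥-height heightP (height-mono {Q} g≤f heightQ)) (chain-height g)

extremal : ∀ b → 1 ≤ b → Realises b (Λ b)
extremal = <-rec (λ b → 1 ≤ b → Realises b (Λ b)) extremal-step
  where
  extremal-step : ∀ b → (∀ {c} → c < b → 1 ≤ c → Realises c (Λ c)) → 1 ≤ b → Realises b (Λ b)
  extremal-step (suc zero) _ _ =
    chain 1 , total⇒vfree (chain 1) (chain-total 1) , chain-ao 1 , chain-height 1 , refl
  extremal-step b@(suc (suc _)) smaller _ with Λ-attained {b} (s≤s (s≤s z≤n))
  ... | f , b≤2f , f<b , Λb≡split =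
    subst₂ Realises (m+[n∸m]≡n (<⇒≤ f<b)) (sym Λb≡split)
      (construction g≤f (smaller f<b (≤-trans 1≤g g≤f)) (smaller g<b 1≤g))
    where
    g : ℕ
    g = b ∸ f
    1≤g : 1 ≤ g
    1≤g = m<n⇒0<n∸m f<b
    g≤f : g ≤ f
    g≤f = split-complement≤ b≤2f
    g<b : g < b
    g<b = split-smaller {f = f} (s≤s (s≤s z≤n)) b≤2f

Λ-isΛ : ∀ b → 1 ≤ b → IsΛ b b (Λ b)
Λ-isΛ b 1≤b = extremal b 1≤b , λ P vfree ao _ → upper-bound P vfree ao

proposition2 : ∀ (a : ℕ) → 2 ≤ a →
    Σ (ℕ → ℕ) λ L →
      (∀ b → 1 ≤ b → b ≤ a → IsΛ b b (L b)) ×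
      (Σ ℕ λ f → a ≤ 2 * f × f < a × L a ≡ term L a f) ×
      (∀ f → a ≤ 2 * f → f < a → term L a f ≤ L a)
proposition2 a 2≤a =
  Λ ,
  (λ b 1≤b _ → Λ-isΛ b 1≤b) ,
  Λ-attained 2≤a ,
  (λ f a≤2f f<a → split≤Λ 2≤a a≤2f f<a)
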